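{- Let $F$ be one of the life-like freezing cellular automata $T01, T02, T11, T12, S01, S02, S03, S11, S12, S13$, let $x$ be a configuration of $G(n)$, and let $$V_+=\Big\{v\in G(n): x_v=0,\ \textstyle\sum_{w\in N(v)}x_w\notin \mathcal{I}_F,\ \sum_{w\in N(v)}x_w+1\in\mathcal{I}_F\Big\}.$$ Then every cell $v\notin V_+$ is either stable for $x$ or infiltrates.
   Context: Cells have two states, $0$ (inactive) and $1$ (active). In the triangular grid, $G(n)$ is a rhombus-shaped region of $2n^2$ triangular cells with periodic (torus) boundary, each cell having 3 neighbors (the cells sharing an edge with it); in the square grid, $G(n)$ is the $n\times n$ torus, each cell having 4 neighbors (von Neumann neighborhood). $N(v)$ denotes the set of neighbors of $v$ (not including $v$). For integers $0\le k_1\le k_2$, the life-like freezing rule with interval $\mathcal{I}_F=\{k_1,\dots,k_2\}$ is $F(x)_u=1$ if $x_u=1$ or $\sum_{w\in N(u)}x_w\in\mathcal{I}_F$, and $F(x)_u=0$ otherwise; it is named $Tk_1k_2$ on the triangular grid and $Sk_1k_2$ on the square grid. A sequential update scheme is a map $\sigma:\mathbb{N}\to G(n)$ such that each consecutive block of $|G(n)|$ time steps is a permutation of the cells; $F^{\sigma(0)}(x)=x$, and at time $t$ only cell $\sigma(t)$ is updated by the local rule. A cell $v$ is stable for $x$ if $F^{\sigma(t)}(x)_v=x_v$ for all $t\ge0$ and all sequential update schemes $\sigma$. An inactive cell $v$ infiltrates if $\sum_{w\in N(v)}x_w\in\mathcal{I}_F$, i.e. it becomes active when it is updated first. -}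

module Defs where

open import Data.Bool using (Bool; true; false; if_then_else_; _∨_)
open import Data.Nat using (ℕ; zero; suc; _+_; _*_; _≤_; _%_)
open import Data.Nat.Properties using (_≤?_)
open import Data.Nat.DivMod using (m%n<n)
open import Data.Fin using (Fin; toℕ; fromℕ<)
import Data.Fin.Properties as FinP
open import Data.Product using (_×_; _,_; ∃)
open import Data.Product.Properties using (≡-dec)
open import Data.List using (List; []; _∷_; map)
open import Data.Nat.ListAction using (sum)
open import Relation.Nullary using (Dec; ¬_)
open import Relation.Nullary.Decidable using (⌊_⌋; _×-dec_)
open import Relation.Binary.PropositionalEquality using (_≡_)
import Data.Bool.Properties as BoolP
open import Data.Sum using (_⊎_)

incF : ∀ {n} → Fin n → Fin n
incF {suc m} i = fromℕ< (m%n<n (suc (toℕ i)) (suc m))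

decF : ∀ {n} → Fin n → Fin n
decF {suc m} i = fromℕ< (m%n<n (toℕ i + m) (suc m))

record Grid : Set₁ where
  field
    Cell  : Set
    _≟_   : (u v : Cell) → Dec (u ≡ v)
    nbrs  : Cell → List Cell
    size  : ℕ

-- Square grid: n × n torus, von Neumann neighbourhood.
squareGrid : ℕ → Grid
squareGrid n = record
  { Cell = Fin n × Fin n
  ; _≟_  = ≡-dec FinP._≟_ FinP._≟_
  ; nbrs = λ { (i , j) → (incF i , j) ∷ (decF i , j) ∷ (i , incF j) ∷ (i , decF j) ∷ [] }
  ; size = n * n
  }

-- Triangular grid: rhombus of 2n² triangles on a torus.
-- Cell (i , j , false) is the "up" triangle of the parallelogram (i , j),
-- (i , j , true) the "down" triangle.
triNbrs : ∀ {n} → Fin n × Fin n × Bool → List (Fin n × Fin n × Bool)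
triNbrs (i , j , false) = (i , j , true) ∷ (decF i , j , true) ∷ (i , decF j , true) ∷ []
triNbrs (i , j , true)  = (i , j , false) ∷ (incF i , j , false) ∷ (i , incF j , false) ∷ []

triGrid : ℕ → Grid
triGrid n = record
  { Cell = Fin n × Fin n × Bool
  ; _≟_  = ≡-dec FinP._≟_ (≡-dec FinP._≟_ BoolP._≟_)
  ; nbrs = triNbrs
  ; size = 2 * (n * n)
  }

data Shape : Set where
  triangular square : Shape

gridOf : Shape → ℕ → Grid
gridOf triangular = triGrid
gridOf square     = squareGrid

data Rule : Set where
  T01 T02 T11 T12 S01 S02 S03 S11 S12 S13 : Rule

shape : Rule → Shape
shape T01 = triangular
shape T02 = triangular
shape T11 = triangular
shape T12 = triangular
shape _   = square

k₁ : Rule → ℕ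
k₁ T01 = 0
k₁ T02 = 0
k₁ T11 = 1
k₁ T12 = 1
k₁ S01 = 0
k₁ S02 = 0
k₁ S03 = 0
k₁ S11 = 1
k₁ S12 = 1
k₁ S13 = 1

k₂ : Rule → ℕ
k₂ T01 = 1
k₂ T02 = 2
k₂ T11 = 1
k₂ T12 = 2
k₂ S01 = 1
k₂ S02 = 2
k₂ S03 = 3
k₂ S11 = 1
k₂ S12 = 2
k₂ S13 = 3

InI : Rule → ℕ → Set
InI F s = k₁ F ≤ s × s ≤ k₂ F

inI? : (F : Rule) → (s : ℕ) → Dec (InI F s)
inI? F s = (k₁ F ≤? s) ×-dec (s ≤? k₂ F)

module Automaton (F : Rule) (n : ℕ) where
  G : Grid
  G = gridOf (shape F) n
  open Grid G public

  Config : Set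
  Config = Cell → Bool

  val : Bool → ℕ
  val true  = 1
  val false = 0

  nsum : Config → Cell → ℕ
  nsum x v = sum (map (λ w → val (x w)) (nbrs v))

  localRule : Config → Cell → Bool
  localRule x u = x u ∨ ⌊ inI? F (nsum x u) ⌋

  updateAt : Cell → Config → Config
  updateAt c x u = if ⌊ u ≟ c ⌋ then localRule x u else x u

  run : (ℕ → Cell) → Config → ℕ → Config
  run σ x zero    = x
  run σ x (suc t) = updateAt (σ t) (run σ x t)

  IsSequential : (ℕ → Cell) → Set
  IsSequential σ = ∀ (k : ℕ) →
      (∀ (c : Cell) → ∃ λ (i : Fin size) → σ (k * size + toℕ i) ≡ c)
    × (∀ (i j : Fin size) → σ (k * size + toℕ i) ≡ σ (k * size + toℕ j) → i ≡ j)

  Stable : Config → Cell → Set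
  Stable x v = ∀ (σ : ℕ → Cell) → IsSequential σ → ∀ (t : ℕ) → run σ x t v ≡ x v

  Infiltrates : Config → Cell → Set
  Infiltrates x v = x v ≡ false × InI F (nsum x v)

  InVplus : Config → Cell → Set
  InVplus x v = x v ≡ false × ¬ InI F (nsum x v) × InI F (nsum x v + 1)

module Submission where

-- A freezing rule never deactivates a cell, so along any run of sequential
-- updates the configuration only grows and every neighbourhood sum only
-- increases.  Hence an active cell is stable, and an inactive cell whose
-- neighbourhood sum already exceeds the top k₂ of the interval I_F can never
-- see a sum in I_F again, so it stays inactive forever and is stable too.
--
-- For each of the ten rules 1 ∈ I_F, and for an interval containing 1 a sum
-- s with s ∉ I_F and s + 1 ∉ I_F lies above the interval.  So an inactive
-- cell outside V₊ either has its sum in I_F (it infiltrates) or its sum is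
-- above k₂ (it is stable).

open import Defs
open import Data.Nat using (ℕ; zero; suc; _+_; _≤_; _<_; z≤n; s≤s)
open import Data.Nat.Properties using (≤-refl; ≤-trans; <-≤-trans; ≰⇒>; <⇒≱; +-mono-≤)
open import Data.Sum using (_⊎_; inj₁; inj₂)
open import Data.Product using (_×_; _,_)
open import Data.Bool using (true; false; _∨_)
open import Data.Bool.Properties using (¬-not) renaming (_≟_ to _≟ᵇ_)
open import Data.List using (List; []; _∷_; map)
open import Data.Nat.ListAction using (sum)
open import Data.Empty using (⊥-elim)
open import Relation.Nullary using (¬_; yes; no)
open import Relation.Nullary.Decidable using (⌊_⌋)
open import Relation.Binary.PropositionalEquality using (_≡_; refl; cong₂; module ≡-Reasoning)

one∈I : (F : Rule) → InI F 1
one∈I T01 = z≤n , s≤s z≤n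
one∈I T02 = z≤n , s≤s z≤n
one∈I T11 = s≤s z≤n , s≤s z≤n
one∈I T12 = s≤s z≤n , s≤s z≤n
one∈I S01 = z≤n , s≤s z≤n
one∈I S02 = z≤n , s≤s z≤n
one∈I S03 = z≤n , s≤s z≤n
one∈I S11 = s≤s z≤n , s≤s z≤n
one∈I S12 = s≤s z≤n , s≤s z≤n
one∈I S13 = s≤s z≤n , s≤s z≤n

-- For an interval [a, b] containing 1, if neither s nor s + 1 lies in it,
-- then s lies above it: s = 0 is excluded since then s + 1 = 1, and a
-- positive s is at least a, so it can only fail to be in [a, b] by s > b.
above-interval : ∀ {a b s} → a ≤ 1 × 1 ≤ b →
  ¬ (a ≤ s × s ≤ b) → ¬ (a ≤ s + 1 × s + 1 ≤ b) → b < s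
above-interval {s = zero}  one∈[a,b] _        ¬s+1∈[a,b] = ⊥-elim (¬s+1∈[a,b] one∈[a,b])
above-interval {s = suc _} (a≤1 , _) ¬s∈[a,b] _          =
  ≰⇒> λ s≤b → ¬s∈[a,b] (≤-trans a≤1 (s≤s z≤n) , s≤b)

inI?-false : ∀ F {s} → ¬ InI F s → ⌊ inI? F s ⌋ ≡ false
inI?-false F {s} s∉I with inI? F s
... | yes s∈I = ⊥-elim (s∉I s∈I)
... | no _    = refl

sum-map-mono : ∀ {A : Set} (f g : A → ℕ) → (∀ a → f a ≤ g a) →
  (as : List A) → sum (map f as) ≤ sum (map g as)
sum-map-mono f g f≤g []       = z≤n
sum-map-mono f g f≤g (a ∷ as) = +-mono-≤ (f≤g a) (sum-map-mono f g f≤g as)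

module _ (F : Rule) (n : ℕ) where
  open Automaton F n

  _⊑_ : Config → Config → Set
  x ⊑ y = ∀ u → x u ≡ true → y u ≡ true

  updateAt-inflationary : ∀ c x → x ⊑ updateAt c x
  updateAt-inflationary c x u xu≡true with u ≟ c
  ... | yes _ rewrite xu≡true = refl
  ... | no _  = xu≡true

  run-inflationary : ∀ σ x t → x ⊑ run σ x t
  run-inflationary σ x zero    u xu≡true = xu≡true
  run-inflationary σ x (suc t) u xu≡true =
    updateAt-inflationary (σ t) (run σ x t) u (run-inflationary σ x t u xu≡true)

  nsum-mono : ∀ {x y} → x ⊑ y → ∀ v → nsum x v ≤ nsum y v
  nsum-mono {x} {y} x⊑y v =
    sum-map-mono (λ w → val (x w)) (λ w → val (y w)) val-mono (nbrs v)
    where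
    val-mono : ∀ w → val (x w) ≤ val (y w)
    val-mono w with x w in xw
    ... | false = z≤n
    ... | true rewrite x⊑y w xw = ≤-refl

  active-stable : ∀ x v → x v ≡ true → Stable x v
  active-stable x v xv≡true σ _ t rewrite xv≡true = run-inflationary σ x t v xv≡true

  -- An inactive cell whose neighbourhood sum exceeds k₂ stays inactive in
  -- every run: its sum only grows, so when it is updated the rule sees a
  -- sum above the interval and leaves it at 0.
  saturated-stays-inactive : ∀ x v → x v ≡ false → k₂ F < nsum x v →
    ∀ σ t → run σ x t v ≡ false
  saturated-stays-inactive x v xv≡false k₂<sum σ zero = xv≡false
  saturated-stays-inactive x v xv≡false k₂<sum σ (suc t) with v ≟ σ t
  ... | no _  = saturated-stays-inactive x v xv≡false k₂<sum σ t
  ... | yes _ = begin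
      y v ∨ ⌊ inI? F (nsum y v) ⌋ ≡⟨ cong₂ _∨_ inactive-before (inI?-false F sum∉I) ⟩
      false                       ∎
    where
    open ≡-Reasoning
    y : Config
    y = run σ x t
    inactive-before : y v ≡ false
    inactive-before = saturated-stays-inactive x v xv≡false k₂<sum σ t
    sum∉I : ¬ InI F (nsum y v)
    sum∉I (_ , sum≤k₂) =
      <⇒≱ (<-≤-trans k₂<sum (nsum-mono (run-inflationary σ x t) v)) sum≤k₂

  saturated-stable : ∀ x v → x v ≡ false → k₂ F < nsum x v → Stable x v
  saturated-stable x v xv≡false k₂<sum σ _ t rewrite xv≡false =
    saturated-stays-inactive x v xv≡false k₂<sum σ t

lemma2 : (F : Rule) (n : ℕ) (x : Automaton.Config F n) (v : Automaton.Cell F n) →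
    ¬ Automaton.InVplus F n x v →
    Automaton.Stable F n x v ⊎ Automaton.Infiltrates F n x v
lemma2 F n x v v∉V₊ with x v ≟ᵇ true
... | yes xv≡true = inj₁ (active-stable F n x v xv≡true)
... | no xv≢true with inI? F (Automaton.nsum F n x v)
...   | yes sum∈I = inj₂ (¬-not xv≢true , sum∈I)
...   | no sum∉I with inI? F (Automaton.nsum F n x v + 1)
...     | yes sum+1∈I = ⊥-elim (v∉V₊ (¬-not xv≢true , sum∉I , sum+1∈I))
...     | no sum+1∉I  = inj₁ (saturated-stable F n x v (¬-not xv≢true) sum-above-I)
  where
  sum-above-I : k₂ F < Automaton.nsum F n x v
  sum-above-I = above-interval (one∈I F) sum∉I sum+1∉I
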